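{- If $p=\langle H,f,f^-,c\rangle$ is a loopless $p$-dialectical system then $L(x)=\lim_s L_s(x)$ exists for every $x$, and for every $x$, \[ f_x\in A_p \iff c\notin H(L(x)\cup\{f_x\}). \]
   Context: An enumeration operator is a c.e. set $H$ of (codes of) pairs $\langle x,D\rangle$, $x\in\omega$, $D\subseteq\omega$ finite; $H(X)=\{x:\exists D\subseteq X\ \langle x,D\rangle\in H\}$. $H$ is an algebraic closure operator if $X\subseteq H(X)$ and $H(H(X))\subseteq H(X)$ for all $X$. A computable approximation $\alpha=\{H_s\}$ to $H$ is a computable increasing sequence of finite sets of pairs with union $H$. A $p$-dialectical system is $p=\langle H,f,f^-,c\rangle$ with $H$ an enumeration operator that is an algebraic closure operator, $H(\emptyset)\ne\emptyset$, $H(\{c\})=\omega$; $f$ a computable permutation of $\omega$ ($f_i=f(i)$); $f^-$ computable and acyclic (every $f^-$-orbit infinite); $c\in\omega$. $p$-dialectical procedure relative to $\alpha$: stacks $r_s(x)$, $m(s)$, finite sets $A_s$; $\rho_s(x)$ = top of $r_s(x)$ when nonempty, $L_s(x)=\{\rho_s(y):y<x,\ r_s(y)\ne\langle\,\rangle\}$, $\chi_s(i)=H_s(L_s(i+1))$. Stage 0: $m(0)=0$, $r_0(0)=\langle f_0\rangle$, other stacks empty, $A_0=\emptyset$. Stage $s+1$, $m=m(s)$: (1) if no $k\le m$ has $c\in\chi_s(k)$: $m(s+1)=m+1$, stacks at $x\le m$ unchanged, $r_{s+1}(m+1)=\langle f_{m+1}\rangle$, stacks above empty; (2) otherwise with $z$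 least such $k$: $m(s+1)=z$, stacks at $x<z$ unchanged, $r_{s+1}(z)=r_s(z)^\frown\langle f^-(\rho_s(z))\rangle$, stacks at $x>z$ empty. $A_{s+1}=\bigcup_{i<m(s+1)}\chi_{s+1}(i)$. Final theses $A_p=\{f_x:\exists t\,\forall s\ge t\ f_x\in A_s\}$ (independent of $\alpha$). $p$ is loopless if for some computable approximation $\alpha$ to $H$, for every $u$ the set $\{\rho_s(u):s\in\omega\}$ is finite; the limits $L(x)$ are taken with respect to such an approximation. -}

module Defs where

open import Data.Nat using (ℕ; zero; suc; _≤_; _<_; _≟_; _≤ᵇ_; _<ᵇ_; _≡ᵇ_)
open import Data.Bool using (Bool; true; false; if_then_else_; _∧_)
open import Data.List using (List; []; _∷_; _++_)
open import Data.Bool.ListAction using (any; all)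
open import Data.List.Membership.Propositional using (_∈_)
open import Data.List.Membership.DecPropositional _≟_ using (_∈?_)
open import Data.List.Relation.Unary.All using (All)
open import Data.Maybe using (Maybe; just; nothing)
open import Data.Product using (Σ; ∃; _×_; _,_)
open import Data.Sum using (_⊎_)
open import Data.Empty using (⊥)
open import Function using (_⇔_)
open import Function.Base using (case_of_)
open import Relation.Nullary using (¬_)
open import Relation.Nullary.Decidable using (⌊_⌋)
open import Relation.Binary.PropositionalEquality using (_≡_)

iter : (ℕ → ℕ) → ℕ → ℕ → ℕ
iter g zero x = x
iter g (suc n) x = g (iter g n x)

-- Subsets of ω are predicates ℕ → Set; finite sets are lists.
-- An enumeration operator is given by its set of pairs ⟨x,D⟩ (D a finite set, as a list):
-- H x D  means  ⟨x,D⟩ ∈ H.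
EnumSet : Set₁
EnumSet = ℕ → List ℕ → Set

App : EnumSet → (ℕ → Set) → ℕ → Set
App H X x = Σ (List ℕ) λ D → All X D × H x D

-- "every f⁻-orbit is infinite": the forward orbit of x is not contained in any finite list
Acyclic : (ℕ → ℕ) → Set
Acyclic g = ∀ x → ¬ (Σ (List ℕ) λ l → ∀ n → iter g n x ∈ l)

-- p-dialectical system ⟨H, f, f⁻, c⟩ (computable = given by Agda functions)
record DSystem : Set₁ where
  field
    H       : EnumSet
    incl    : ∀ (X : ℕ → Set) x → X x → App H X x
    idem    : ∀ (X : ℕ → Set) x → App H (App H X) x → App H X x
    nonempt : Σ ℕ λ x → App H (λ _ → ⊥) x
    c       : ℕ
    full    : ∀ x → App H (λ y → y ≡ c) x
    f       : ℕ → ℕ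
    finv    : ℕ → ℕ
    f-finv  : ∀ x → f (finv x) ≡ x
    finv-f  : ∀ x → finv (f x) ≡ x
    f⁻      : ℕ → ℕ
    acyc    : Acyclic f⁻

record Approx (H : EnumSet) : Set where
  field
    stage    : ℕ → List (ℕ × List ℕ)
    mono     : ∀ s p → p ∈ stage s → p ∈ stage (suc s)
    sound    : ∀ s x D → (x , D) ∈ stage s → H x D
    complete : ∀ x D → H x D → Σ ℕ λ s → (x , D) ∈ stage s

inHs : List (ℕ × List ℕ) → List ℕ → ℕ → Bool
inHs Hs L y = any (λ { (y' , D) → ⌊ y' ≟ y ⌋ ∧ all (λ d → ⌊ d ∈? L ⌋) D }) Hs

-- State of the procedure: m(s) and the stacks r_s(x) (lists, head = top)
record State : Set where
  constructor st
  field
    m : ℕ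
    r : ℕ → List ℕ

top : List ℕ → Maybe ℕ
top [] = nothing
top (v ∷ _) = just v

Lst : (ℕ → List ℕ) → ℕ → List ℕ
Lst r zero = []
Lst r (suc x) = Lst r x ++ (case r x of λ { [] → [] ; (v ∷ _) → v ∷ [] })

least : (ℕ → Bool) → ℕ → Maybe ℕ
least p zero = if p zero then just zero else nothing
least p (suc m) with least p m
... | just k = just k
... | nothing = if p (suc m) then just (suc m) else nothing

module Procedure (P : DSystem) (α : Approx (DSystem.H P)) where
  open DSystem P
  open Approx α

  χ : ℕ → (ℕ → List ℕ) → ℕ → ℕ → Bool
  χ s r i y = inHs (stage s) (Lst r (suc i)) y

  push : List ℕ → List ℕ
  push [] = []            -- never used: stacks at x ≤ m(s) are nonempty
  push (v ∷ vs) = f⁻ v ∷ v ∷ vs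

  step : ℕ → State → State
  step s (st m r) with least (λ k → χ s r k c) m
  ... | nothing = st (suc m) (λ x → if x ≤ᵇ m then r x
                                    else if x ≡ᵇ suc m then f (suc m) ∷ [] else [])
  ... | just z  = st z (λ x → if x <ᵇ z then r x
                               else if x ≡ᵇ z then push (r z) else [])

  state : ℕ → State
  state zero = st zero (λ x → if x ≡ᵇ zero then f zero ∷ [] else [])
  state (suc s) = step s (state s)

  mS : ℕ → ℕ
  mS s = State.m (state s)

  rS : ℕ → ℕ → List ℕ
  rS s = State.r (state s)

  L : ℕ → ℕ → List ℕ
  L s x = Lst (rS s) x

  InA : ℕ → ℕ → Set
  InA s y = Σ ℕ λ i → i < mS s × χ s (rS s) i y ≡ true

  InAp : ℕ → Set
  InAp y = Σ ℕ λ t → ∀ s → t ≤ s → InA s y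

  Loopless : Set
  Loopless = ∀ u → Σ (List ℕ) λ l → ∀ s v → top (rS s u) ≡ just v → v ∈ l

  Lim : ℕ → List ℕ → Set
  Lim x Λ = Σ ℕ λ t → ∀ s → t ≤ s → ∀ y → (y ∈ L s x ⇔ y ∈ Λ)

module Submission where

-- Induct on x to find a stage after which m(s) > x and every retreat goes to a position > x, so that the
-- stacks at positions ≤ x are frozen.  Given this for x, either retreats to x + 1 eventually stop, or
-- they recur forever; each one pushes f⁻ of the top onto the stack at x + 1, so the tops there would run
-- through an infinite f⁻-orbit inside the finite set given by looplessness, contradicting acyclicity.
-- (This dichotomy is the only use of excluded middle.)  Afterwards L(x) is frozen.  If the frozen
-- stack at x was ever pushed, its first push happened while it was ⟨f x⟩, which means
-- c ∈ H(L(x) ∪ {f x}); otherwise f x ∈ L(x+1), so f x ∈ χ_s(x) ⊆ A_s for all large s.  Conversely,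
-- c ∈ H(L(x) ∪ {f x}) keeps f x from being a thesis forever, by descent on the witnessing position.

open import Defs
open import Axiom.DoubleNegationElimination using (em⇒dne)
open import Axiom.ExcludedMiddle using (ExcludedMiddle)
open import Data.Bool using (true; false; T; if_then_else_)
open import Data.Bool.Properties using (T-≡; T-∧)
open import Data.Empty using (⊥; ⊥-elim)
open import Data.List using (List; []; _∷_; _++_; length)
open import Data.List.Membership.Propositional using (_∈_; find; lose)
open import Data.List.Membership.Propositional.Properties using (∈-++⁺ˡ; ∈-++⁺ʳ; ∈-++⁻)
open import Data.List.Relation.Unary.All using (All) renaming (map to All-map)
open import Data.List.Relation.Unary.All.Properties using (all⁺; all⁻)
open import Data.List.Relation.Unary.Any using (here)
open import Data.List.Relation.Unary.Any.Properties using (any⁺; any⁻)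
open import Data.Maybe using (Maybe; just; nothing)
open import Data.Maybe.Properties using (just-injective)
open import Data.Nat using (ℕ; zero; suc; pred; _+_; _⊔_; _≤_; _<_; _≤′_; ≤′-refl; ≤′-step; _≤?_; z≤n; s≤s)
open import Data.Nat.Induction using (<-rec)
open import Data.Nat.Properties
open import Data.Product using (Σ; _×_; _,_; proj₁; proj₂; map₁; map₂)
open import Data.Sum using (_⊎_; inj₁; inj₂)
open import Function using (_∘_)
open import Function.Bundles using (_⇔_; mk⇔; Equivalence)
open import Level using (0ℓ)
open import Relation.Nullary using (¬_; yes; no)
open import Relation.Nullary.Decidable using (toWitness; fromWitness)
open import Relation.Binary.PropositionalEquality
open ≡-Reasoning

if-true : ∀ {A : Set} {b} {x y : A} → T b → (if b then x else y) ≡ x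
if-true {b = true} _ = refl

if-false : ∀ {A : Set} {b} {x y : A} → ¬ T b → (if b then x else y) ≡ y
if-false {b = false} _ = refl
if-false {b = true} ¬t = ⊥-elim (¬t _)

induction-from : ∀ (Q : ℕ → Set) {T} → Q T → (∀ {s} → T ≤ s → Q s → Q (suc s)) →
  ∀ {s} → T ≤ s → Q s
induction-from Q {T} qT qs = go ∘ ≤⇒≤′
  where
  go : ∀ {s} → T ≤′ s → Q s
  go ≤′-refl = qT
  go (≤′-step T≤′s) = qs (≤′⇒≤ T≤′s) (go T≤′s)

nondecreasing-from : ∀ (g : ℕ → ℕ) {T} → (∀ {s} → T ≤ s → g s ≤ g (suc s)) →
  ∀ {s s'} → T ≤ s → s ≤ s' → g s ≤ g s'
nondecreasing-from g step {s} T≤s =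
  induction-from (λ s' → g s ≤ g s') ≤-refl (λ s≤s' ih → ≤-trans ih (step (≤-trans T≤s s≤s')))

unit-steps-hit : ∀ (g : ℕ → ℕ) {T} → (∀ {s} → T ≤ s → g (suc s) ≤ suc (g s)) →
  ∀ {s v} → T ≤ s → g T ≤ v → v ≤ g s → Σ ℕ λ s' → T ≤ s' × g s' ≡ v
unit-steps-hit g {T} step {v = v} T≤s = induction-from Hits base next T≤s
  where
  Hits : ℕ → Set
  Hits s = g T ≤ v → v ≤ g s → Σ ℕ λ s' → T ≤ s' × g s' ≡ v
  base : Hits T
  base gT≤v v≤gT = T , ≤-refl , ≤-antisym gT≤v v≤gT
  next : ∀ {s} → T ≤ s → Hits s → Hits (suc s)
  next {s} T≤s ih gT≤v v≤gs′ with v ≤? g s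
  ... | yes v≤gs = ih gT≤v v≤gs
  ... | no v≰gs = suc s , m≤n⇒m≤1+n T≤s , ≤-antisym (≤-trans (step T≤s) (≰⇒> v≰gs)) v≤gs′

m≤n⊔o∧o<m⇒m≤n : ∀ {m n o} → m ≤ n ⊔ o → o < m → m ≤ n
m≤n⊔o∧o<m⇒m≤n {m} {n} {o} m≤n⊔o o<m with ⊔-sel n o
... | inj₁ n⊔o≡n = subst (m ≤_) n⊔o≡n m≤n⊔o
... | inj₂ n⊔o≡o = ⊥-elim (<⇒≱ o<m (subst (m ≤_) n⊔o≡o m≤n⊔o))

iter-+ : ∀ g j k x → iter g j (iter g k x) ≡ iter g (j + k) x
iter-+ g zero k x = refl
iter-+ g (suc j) k x = cong g (iter-+ g j k x)

∈-∷ʳ⁻ : ∀ xs {a v : ℕ} → v ∈ xs ++ a ∷ [] → v ∈ xs ⊎ v ≡ a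
∈-∷ʳ⁻ xs v∈ with ∈-++⁻ xs v∈
... | inj₁ v∈xs = inj₁ v∈xs
... | inj₂ (here v≡a) = inj₂ v≡a

least-sound : ∀ p m {z} → least p m ≡ just z → z ≤ m × p z ≡ true
least-sound p zero eq with p zero in pz
least-sound p zero refl | true = z≤n , pz
least-sound p zero () | false
least-sound p (suc m) eq with least p m in eqm
least-sound p (suc m) refl | just z = map₁ m≤n⇒m≤1+n (least-sound p m eqm)
... | nothing with p (suc m) in ps
least-sound p (suc m) refl | nothing | true = ≤-refl , ps
least-sound p (suc m) () | nothing | false

least-complete : ∀ p m {k} → p k ≡ true → k ≤ m → Σ ℕ λ z → least p m ≡ just z × z ≤ k
least-complete p zero pk z≤n rewrite pk = zero , refl , z≤n
least-complete p (suc m) pk k≤1+m with m≤n⇒m<n∨m≡n k≤1+m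
... | inj₁ k<1+m with least-complete p m pk (≤-pred k<1+m)
...   | z , eq , z≤k rewrite eq = z , refl , z≤k
least-complete p (suc m) pk _ | inj₂ refl with least p m in eq
... | just z = z , refl , m≤n⇒m≤1+n (proj₁ (least-sound p m eq))
... | nothing rewrite pk = suc m , refl , ≤-refl

Lst-cong : ∀ r r' x → (∀ {y} → y < x → r y ≡ r' y) → Lst r x ≡ Lst r' x
Lst-cong r r' zero _ = refl
Lst-cong r r' (suc x) r≗r'
  rewrite Lst-cong r r' x (r≗r' ∘ m<n⇒m<1+n) | r≗r' (n<1+n x) = refl

Lst-mono : ∀ r {a b v} → a ≤ b → v ∈ Lst r a → v ∈ Lst r b
Lst-mono r = go ∘ ≤⇒≤′
  where
  go : ∀ {a b v} → a ≤′ b → v ∈ Lst r a → v ∈ Lst r b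
  go ≤′-refl v∈ = v∈
  go (≤′-step a≤′b) v∈ = ∈-++⁺ˡ (go a≤′b v∈)

Lst-suc : ∀ r x {v vs} → r x ≡ v ∷ vs → Lst r (suc x) ≡ Lst r x ++ v ∷ []
Lst-suc r x eq rewrite eq = refl

inHs-sound : ∀ Hs K {y} → inHs Hs K y ≡ true → Σ (List ℕ) λ D → (y , D) ∈ Hs × All (_∈ K) D
inHs-sound Hs K y∈ with find (any⁻ _ Hs (Equivalence.from T-≡ y∈))
... | (y' , D) , p∈Hs , t with Equivalence.to T-∧ t
...   | y'≡y , D⊆K = D , subst (λ u → (u , D) ∈ Hs) (toWitness y'≡y) p∈Hs ,
                     All-map toWitness (all⁺ _ D D⊆K)

inHs-complete : ∀ {Hs K y D} → (y , D) ∈ Hs → All (_∈ K) D → inHs Hs K y ≡ true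
inHs-complete p∈Hs D⊆K = Equivalence.to T-≡ (any⁺ _ (lose p∈Hs
  (Equivalence.from T-∧ (fromWitness refl , all⁻ _ (All-map fromWitness D⊆K)))))

nothing≢just : ∀ {a : ℕ} → nothing ≢ just a
nothing≢just ()

App-mono : ∀ H {X Y : ℕ → Set} → (∀ {y} → X y → Y y) → ∀ {z} → App H X z → App H Y z
App-mono H X⊆Y (D , D⊆X , hD) = D , All-map X⊆Y D⊆X , hD

module Run (P : DSystem) (α : Approx (DSystem.H P)) where
  open DSystem P
  open Approx α
  open Procedure P α

  App-closed : ∀ {X Y : ℕ → Set} → (∀ {y} → X y → App H Y y) → ∀ {z} → App H X z → App H Y z
  App-closed {Y = Y} X⊆HY = idem Y _ ∘ App-mono H X⊆HY

  stage-mono : ∀ {p s s'} → s ≤ s' → p ∈ stage s → p ∈ stage s'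
  stage-mono {p} s≤s' p∈ = induction-from (λ s' → p ∈ stage s') p∈ (λ _ → mono _ p) s≤s'

  enumerated-eventually : ∀ {K y} → App H (_∈ K) y →
    Σ ℕ λ s₀ → ∀ {s} → s₀ ≤ s → inHs (stage s) K y ≡ true
  enumerated-eventually (D , D⊆K , hD) =
    let s₀ , p∈ = complete _ D hD in s₀ , λ s₀≤s → inHs-complete (stage-mono s₀≤s p∈) D⊆K

  enumerated-sound : ∀ {s K y} → inHs (stage s) K y ≡ true → App H (_∈ K) y
  enumerated-sound {s} {K} y∈ =
    let D , p∈ , D⊆K = inHs-sound (stage s) K y∈ in D , D⊆K , sound s _ D p∈

  conflict : ℕ → Maybe ℕ
  conflict s = least (λ k → χ s (rS s) k c) (mS s)

  conflict⇒inconsistent : ∀ s {z} → conflict s ≡ just z → App H (_∈ L s (suc z)) c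
  conflict⇒inconsistent s eq = enumerated-sound (proj₂ (least-sound _ (mS s) eq))

  stack : ℕ → ℕ → List ℕ
  stack y zero = f y ∷ []
  stack y (suc n) = iter f⁻ (suc n) (f y) ∷ stack y n

  push-stack : ∀ y n → push (stack y n) ≡ stack y (suc n)
  push-stack y zero = refl
  push-stack y (suc n) = refl

  top-stack : ∀ y n → top (stack y n) ≡ just (iter f⁻ n (f y))
  top-stack y zero = refl
  top-stack y (suc n) = refl

  length-stack : ∀ y n → length (stack y n) ≡ suc n
  length-stack y zero = refl
  length-stack y (suc n) = cong suc (length-stack y n)

  -- Stated for an explicit state st m r: only then does with-abstraction reach the with inside step.
  module _ (s m : ℕ) (r : ℕ → List ℕ) where

    advance : least (λ k → χ s r k c) m ≡ nothing →
      State.m (step s (st m r)) ≡ suc m ×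
      (∀ {y} → y < suc m → State.r (step s (st m r)) y ≡ r y) ×
      State.r (step s (st m r)) (suc m) ≡ stack (suc m) 0
    advance _ with least (λ k → χ s r k c) m
    ... | nothing = refl , (λ y<1+m → if-true (≤⇒≤ᵇ (≤-pred y<1+m))) ,
      trans (if-false (n≮n m ∘ ≤ᵇ⇒≤ (suc m) m)) (if-true (≡⇒≡ᵇ (suc m) (suc m) refl))
    advance () | just _

    retreat : ∀ {z} → least (λ k → χ s r k c) m ≡ just z →
      State.m (step s (st m r)) ≡ z ×
      (∀ {y} → y < z → State.r (step s (st m r)) y ≡ r y) ×
      State.r (step s (st m r)) z ≡ push (r z)
    retreat {z} _ with least (λ k → χ s r k c) m
    retreat {z} refl | just .z = refl , (λ y<z → if-true (<⇒<ᵇ y<z)) ,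
      trans (if-false (n≮n z ∘ <ᵇ⇒< z z)) (if-true (≡⇒≡ᵇ z z refl))
    retreat () | nothing

  data StepView (s : ℕ) : Set where
    advanced : conflict s ≡ nothing → mS (suc s) ≡ suc (mS s) →
      (∀ {y} → y < suc (mS s) → rS (suc s) y ≡ rS s y) →
      rS (suc s) (suc (mS s)) ≡ stack (suc (mS s)) 0 → StepView s
    retreated : ∀ {z} → conflict s ≡ just z → z ≤ mS s → mS (suc s) ≡ z →
      (∀ {y} → y < z → rS (suc s) y ≡ rS s y) →
      rS (suc s) z ≡ push (rS s z) → StepView s

  stepView : ∀ s → StepView s
  stepView s with conflict s in eq
  ... | nothing = let m≡ , frozen , fresh = advance s (mS s) (rS s) eq in advanced eq m≡ frozen fresh
  ... | just z = let m≡ , frozen , pushed = retreat s (mS s) (rS s) eq in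
    retreated eq (proj₁ (least-sound _ (mS s) eq)) m≡ frozen pushed

  mS-after-retreat : ∀ s {z} → conflict s ≡ just z → mS (suc s) ≡ z
  mS-after-retreat s eq with stepView s
  ... | advanced eq′ _ _ _ = ⊥-elim (nothing≢just (trans (sym eq′) eq))
  ... | retreated eq′ _ m≡ _ _ = trans m≡ (just-injective (trans (sym eq′) eq))

  stack-shape : ∀ s {y} → y ≤ mS s → Σ ℕ λ n → rS s y ≡ stack y n
  stack-shape zero {zero} _ = 0 , refl
  stack-shape (suc s) y≤m with stepView s
  ... | advanced _ m≡ frozen fresh with m≤n⇒m<n∨m≡n (subst (_ ≤_) m≡ y≤m)
  ...   | inj₁ y<1+m = map₂ (trans (frozen y<1+m)) (stack-shape s (≤-pred y<1+m))
  ...   | inj₂ refl = 0 , fresh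
  stack-shape (suc s) y≤m | retreated _ z≤m m≡ frozen pushed with m≤n⇒m<n∨m≡n (subst (_ ≤_) m≡ y≤m)
  ... | inj₁ y<z = map₂ (trans (frozen y<z)) (stack-shape s (≤-trans (<⇒≤ y<z) z≤m))
  ... | inj₂ refl = let n , shape = stack-shape s z≤m in
    suc n , trans pushed (trans (cong push shape) (push-stack _ n))

  singleton≢stack-suc : ∀ y n → stack y 0 ≢ stack y (suc n)
  singleton≢stack-suc y n e with trans (cong length e) (length-stack y (suc n))
  ... | ()

  -- The equation says that at stage s′ the stack at y was still ⟨f y⟩ and the stacks below y were as at s.
  RetreatedFromSingleton : ℕ → ℕ → Set
  RetreatedFromSingleton s y = Σ ℕ λ s' → conflict s' ≡ just y × L s' (suc y) ≡ L s y ++ f y ∷ []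

  retreated-from-singleton-cong : ∀ s s' {y} → (∀ {w} → w < y → rS s w ≡ rS s' w) →
    RetreatedFromSingleton s y → RetreatedFromSingleton s' y
  retreated-from-singleton-cong s s' {y} same =
    map₂ (map₂ (λ e → trans e (cong (_++ f y ∷ []) (Lst-cong (rS s) (rS s') y same))))

  pushed⇒retreated-from-singleton : ∀ s {y n} → y ≤ mS s → rS s y ≡ stack y (suc n) →
    RetreatedFromSingleton s y
  pushed⇒retreated-from-singleton zero {zero} _ shape = ⊥-elim (singleton≢stack-suc 0 _ shape)
  pushed⇒retreated-from-singleton (suc s) y≤m shape with stepView s
  ... | advanced _ m≡ frozen fresh with m≤n⇒m<n∨m≡n (subst (_ ≤_) m≡ y≤m)
  ...   | inj₁ y<1+m = retreated-from-singleton-cong s (suc s) (λ w<y → sym (frozen (<-trans w<y y<1+m)))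
    (pushed⇒retreated-from-singleton s (≤-pred y<1+m) (trans (sym (frozen y<1+m)) shape))
  ...   | inj₂ refl = ⊥-elim (singleton≢stack-suc _ _ (trans (sym fresh) shape))
  pushed⇒retreated-from-singleton (suc s) y≤m shape | retreated eq z≤m m≡ frozen _
    with m≤n⇒m<n∨m≡n (subst (_ ≤_) m≡ y≤m)
  ... | inj₁ y<z = retreated-from-singleton-cong s (suc s) (λ w<y → sym (frozen (<-trans w<y y<z)))
    (pushed⇒retreated-from-singleton s (≤-trans (<⇒≤ y<z) z≤m) (trans (sym (frozen y<z)) shape))
  ... | inj₂ refl = retreated-from-singleton-cong s (suc s) (sym ∘ frozen) (at-stage-s (stack-shape s z≤m))
    where
    at-stage-s : (Σ ℕ λ n → rS s _ ≡ stack _ n) → RetreatedFromSingleton s _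
    at-stage-s (zero , single) = s , eq , Lst-suc (rS s) _ single
    at-stage-s (suc _ , pushed) = pushed⇒retreated-from-singleton s z≤m pushed

  LaterRetreat≤ : ℕ → ℕ → Set
  LaterRetreat≤ i s = Σ ℕ λ s₁ → Σ ℕ λ z → s ≤ s₁ × conflict s₁ ≡ just z × z ≤ i

  retreat-or-frozen : ∀ {i s} → i < mS s → ∀ k →
    LaterRetreat≤ i s ⊎ (i < mS (k + s) × (∀ {y} → y ≤ i → rS (k + s) y ≡ rS s y))
  retreat-or-frozen i<m zero = inj₂ (i<m , λ _ → refl)
  retreat-or-frozen {i} {s} i<m (suc k) with retreat-or-frozen i<m k
  ... | inj₁ later = inj₁ later
  ... | inj₂ (i<m′ , same) with stepView (k + s)
  ...   | advanced _ m≡ frozen _ = inj₂ (subst (i <_) (sym m≡) (m<n⇒m<1+n i<m′) ,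
          λ y≤i → trans (frozen (m<n⇒m<1+n (≤-<-trans y≤i i<m′))) (same y≤i))
  ...   | retreated {z} eq _ m≡ frozen _ with z ≤? i
  ...     | yes z≤i = inj₁ (k + s , z , m≤n+m s k , eq , z≤i)
  ...     | no z≰i = inj₂ (subst (i <_) (sym m≡) (≰⇒> z≰i) ,
          λ y≤i → trans (frozen (≤-<-trans y≤i (≰⇒> z≰i))) (same y≤i))

  eventually-retreats : ∀ {i s} → i < mS s → App H (_∈ L s (suc i)) c → LaterRetreat≤ i s
  eventually-retreats {i} {s} i<m inconsistent with enumerated-eventually inconsistent
  ... | s₀ , enumerated with retreat-or-frozen i<m s₀
  ...   | inj₁ later = later
  ...   | inj₂ (i<m′ , same) =
    let z , eq , z≤i = least-complete _ (mS (s₀ + s))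
          (subst (λ K → inHs (stage (s₀ + s)) K c ≡ true)
            (sym (Lst-cong (rS (s₀ + s)) (rS s) (suc i) (same ∘ ≤-pred)))
            (enumerated (m≤m+n s₀ s)))
          (<⇒≤ i<m′)
    in s₀ + s , z , m≤n+m s s₀ , eq , z≤i

  Settled : ℕ → ℕ → Set
  Settled x T = ∀ {s} → T ≤ s → x ≤ mS s × (∀ {z} → conflict s ≡ just z → x ≤ z)

  settled-frozen : ∀ {x T} → Settled x T → ∀ {y s} → y < x → T ≤ s → rS s y ≡ rS T y
  settled-frozen {T = T} settled {y} y<x = induction-from (λ s → rS s y ≡ rS T y) refl next
    where
    next : ∀ {s} → T ≤ s → rS s y ≡ rS T y → rS (suc s) y ≡ rS T y
    next {s} T≤s ih with stepView s
    ... | advanced _ _ frozen _ = trans (frozen (m<n⇒m<1+n (<-≤-trans y<x (proj₁ (settled T≤s))))) ih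
    ... | retreated eq _ _ frozen _ = trans (frozen (<-≤-trans y<x (proj₂ (settled T≤s) eq))) ih

  L-settled : ∀ {x T} → Settled x T → ∀ {y s} → y ≤ x → T ≤ s → L s y ≡ L T y
  L-settled settled {y} {s} y≤x T≤s =
    Lst-cong (rS s) _ y (λ w<y → settled-frozen settled (<-≤-trans w<y y≤x) T≤s)

  module Stabilisation (em : ExcludedMiddle 0ℓ) (loopless : Loopless) where

    module _ {x T} (settled : Settled x T) where

      height : ℕ → ℕ
      height s = pred (length (rS s x))

      stack-at : ∀ {s} → T ≤ s → rS s x ≡ stack x (height s)
      stack-at {s} T≤s =
        let n , shape = stack-shape s (proj₁ (settled T≤s))
            height≡n = trans (cong (pred ∘ length) shape) (cong pred (length-stack x n))
        in trans shape (cong (stack x) (sym height≡n))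

      height-step : ∀ {s} → T ≤ s →
        (conflict s ≢ just x × height (suc s) ≡ height s) ⊎
        (conflict s ≡ just x × height (suc s) ≡ suc (height s))
      height-step {s} T≤s with stepView s
      ... | advanced eq _ frozen _ = inj₁ ((λ e → nothing≢just (trans (sym eq) e)) ,
        cong (pred ∘ length) (frozen (s≤s (proj₁ (settled T≤s)))))
      ... | retreated eq _ _ frozen pushed with m≤n⇒m<n∨m≡n (proj₂ (settled T≤s) eq)
      ...   | inj₁ x<z = inj₁ ((λ e → <⇒≢ x<z (just-injective (trans (sym e) eq))) ,
        cong (pred ∘ length) (frozen x<z))
      ...   | inj₂ refl = inj₂ (eq , trans (cong (pred ∘ length) (begin
        rS (suc s) x                 ≡⟨ pushed ⟩
        push (rS s x)                ≡⟨ cong push (stack-at T≤s) ⟩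
        push (stack x (height s))    ≡⟨ push-stack x (height s) ⟩
        stack x (suc (height s))     ∎)) (cong pred (length-stack x (suc (height s)))))

      height-nondecreasing : ∀ {s} → T ≤ s → height s ≤ height (suc s)
      height-nondecreasing {s} T≤s with height-step T≤s
      ... | inj₁ (_ , same) = ≤-reflexive (sym same)
      ... | inj₂ (_ , pushed) = ≤-trans (n≤1+n (height s)) (≤-reflexive (sym pushed))

      height-unit-step : ∀ {s} → T ≤ s → height (suc s) ≤ suc (height s)
      height-unit-step {s} T≤s with height-step T≤s
      ... | inj₁ (_ , same) = ≤-trans (≤-reflexive same) (n≤1+n (height s))
      ... | inj₂ (_ , pushed) = ≤-reflexive pushed

      height-push : ∀ {s} → T ≤ s → conflict s ≡ just x → height (suc s) ≡ suc (height s)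
      height-push T≤s eq with height-step T≤s
      ... | inj₁ (≢x , _) = ⊥-elim (≢x eq)
      ... | inj₂ (_ , pushed) = pushed

      recurrent-retreat-impossible : ¬ (∀ T₀ → Σ ℕ λ s → T₀ ≤ s × conflict s ≡ just x)
      recurrent-retreat-impossible recurrent = acyc (iter f⁻ (height T) (f x)) (tops , orbit⊆tops)
        where
        tops : List ℕ
        tops = proj₁ (loopless x)

        unbounded : ∀ k → Σ ℕ λ s → T ≤ s × k ≤ height s
        unbounded zero = T , ≤-refl , z≤n
        unbounded (suc k) =
          let s , T≤s , k≤h = unbounded k
              s₂ , s≤s₂ , eq = recurrent s
              T≤s₂ = ≤-trans T≤s s≤s₂
          in suc s₂ , m≤n⇒m≤1+n T≤s₂ ,
             subst (suc k ≤_) (sym (height-push T≤s₂ eq))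
               (s≤s (≤-trans k≤h (nondecreasing-from height height-nondecreasing T≤s s≤s₂)))

        orbit⊆tops : ∀ j → iter f⁻ j (iter f⁻ (height T) (f x)) ∈ tops
        orbit⊆tops j =
          let s , T≤s , k≤h = unbounded (j + height T)
              s′ , T≤s′ , h≡ = unit-steps-hit height height-unit-step T≤s (m≤n+m (height T) j) k≤h
          in proj₂ (loopless x) s′ _ (begin
            top (rS s′ x)                        ≡⟨ cong top (stack-at T≤s′) ⟩
            top (stack x (height s′))            ≡⟨ top-stack x (height s′) ⟩
            just (iter f⁻ (height s′) (f x))     ≡⟨ cong (λ n → just (iter f⁻ n (f x))) h≡ ⟩
            just (iter f⁻ (j + height T) (f x))  ≡⟨ cong just (iter-+ f⁻ j (height T) (f x)) ⟨
            just (iter f⁻ j (iter f⁻ (height T) (f x))) ∎)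

      quiet⇒settled : ∀ {T₀} → (∀ {s} → T₀ ≤ s → conflict s ≢ just x) →
        Settled (suc x) (suc (T₀ ⊔ T))
      quiet⇒settled {T₀} quiet {suc s} (s≤s le) = mS-beyond , retreat-beyond (m≤n⇒m≤1+n le)
        where
        retreat-beyond : ∀ {s z} → T₀ ⊔ T ≤ s → conflict s ≡ just z → suc x ≤ z
        retreat-beyond le eq with m≤n⇒m<n∨m≡n (proj₂ (settled (≤-trans (m≤n⊔m T₀ T) le)) eq)
        ... | inj₁ x<z = x<z
        ... | inj₂ refl = ⊥-elim (quiet (≤-trans (m≤m⊔n T₀ T) le) eq)

        mS-beyond : suc x ≤ mS (suc s)
        mS-beyond with stepView s
        ... | advanced _ m≡ _ _ =
          subst (suc x ≤_) (sym m≡) (s≤s (proj₁ (settled (≤-trans (m≤n⊔m T₀ T) le))))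
        ... | retreated eq _ m≡ _ _ = subst (suc x ≤_) (sym m≡) (retreat-beyond le eq)

      settle-next : Σ ℕ (Settled (suc x))
      settle-next with em {Σ ℕ λ T₀ → ∀ {s} → T₀ ≤ s → conflict s ≢ just x}
      ... | yes (T₀ , quiet) = suc (T₀ ⊔ T) , quiet⇒settled quiet
      ... | no ¬quiet = ⊥-elim (recurrent-retreat-impossible λ T₀ →
        em⇒dne em λ ¬recurrent → ¬quiet (T₀ , λ T₀≤s eq → ¬recurrent (_ , T₀≤s , eq)))

    eventually-settled : ∀ x → Σ ℕ (Settled x)
    eventually-settled zero = zero , λ _ → z≤n , λ _ → z≤n
    eventually-settled (suc x) = settle-next (proj₂ (eventually-settled x))

  module _ {x T} (settled : Settled (suc x) T) where

    x<mS : ∀ {s} → T ≤ s → x < mS s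
    x<mS = proj₁ ∘ settled

    consistent⇒thesis : ¬ App H (λ y → y ∈ L T x ⊎ y ≡ f x) c → InAp (f x)
    consistent⇒thesis consistent with stack-shape T (<⇒≤ (x<mS ≤-refl))
    ... | suc _ , pushed =
      let s′ , eq , L≡ = pushed⇒retreated-from-singleton T (<⇒≤ (x<mS ≤-refl)) pushed
      in ⊥-elim (consistent (App-mono H (λ {v} v∈ → ∈-∷ʳ⁻ (L T x) (subst (v ∈_) L≡ v∈))
                              (conflict⇒inconsistent s′ eq)))
    ... | zero , single =
      let fx∈ = subst (f x ∈_) (sym (Lst-suc (rS T) x single)) (∈-++⁺ʳ (L T x) (here refl))
          s₀ , enumerated = enumerated-eventually (incl (_∈ L T (suc x)) (f x) fx∈)
      in T ⊔ s₀ , λ s le →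
        x , x<mS (≤-trans (m≤m⊔n T s₀) le) ,
        subst (λ K → inHs (stage s) K (f x) ≡ true)
          (sym (L-settled settled ≤-refl (≤-trans (m≤m⊔n T s₀) le)))
          (enumerated (≤-trans (m≤n⊔m T s₀) le))

    thesis⇒consistent : InAp (f x) → ¬ App H (λ y → y ∈ L T x ⊎ y ≡ f x) c
    thesis⇒consistent (t , thesis) inconsistent =
      let i , i<m , fx∈χ = thesis (t ⊔ T) (m≤m⊔n t T)
      in no-thesis-from i ≤-refl i<m (enumerated-sound fx∈χ)
      where
      inconsistent-at : ∀ {s j} → T ≤ s → x ≤ j →
        App H (_∈ L s (suc j)) (f x) → App H (_∈ L s (suc j)) c
      inconsistent-at {s} {j} T≤s x≤j fx∈H = App-closed below inconsistent
        where
        below : ∀ {y} → y ∈ L T x ⊎ y ≡ f x → App H (_∈ L s (suc j)) y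
        below {y} (inj₁ y∈L) = incl _ y (Lst-mono (rS s) (m≤n⇒m≤1+n x≤j)
          (subst (y ∈_) (sym (L-settled settled (n≤1+n x) T≤s)) y∈L))
        below (inj₂ refl) = fx∈H

      -- c ∈ H(L_s(i+1)) forces a retreat to some z with x < z ≤ i, after which f x is a thesis only via a
      -- position below z: an infinite descent.
      no-thesis-from : ∀ i {s} → t ⊔ T ≤ s → i < mS s → ¬ App H (_∈ L s (suc i)) (f x)
      no-thesis-from = <-rec _ λ i descend {s} le i<m fx∈H →
        let T≤s = ≤-trans (m≤n⊔m t T) le
            s₁ , z , s≤s₁ , eq , z≤i⊔x = eventually-retreats (⊔-pres-<m i<m (x<mS T≤s))
              (inconsistent-at T≤s (m≤n⊔m i x) (App-mono H (Lst-mono (rS s) (s≤s (m≤m⊔n i x))) fx∈H))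
            le′ = ≤-trans le (m≤n⇒m≤1+n s≤s₁)
            z≤i = m≤n⊔o∧o<m⇒m≤n z≤i⊔x (proj₂ (settled (≤-trans T≤s s≤s₁)) eq)
            i′ , i′<m , fx∈χ = thesis (suc s₁) (≤-trans (m≤m⊔n t T) le′)
        in descend (<-≤-trans (subst (i′ <_) (mS-after-retreat s₁ eq) i′<m) z≤i) le′ i′<m
             (enumerated-sound fx∈χ)

theorem1p10 : ExcludedMiddle 0ℓ → (P : DSystem) → (α : Approx (DSystem.H P)) →
    Procedure.Loopless P α →
    ∀ x → Σ (List ℕ) λ Λ → Procedure.Lim P α x Λ ×
      (Procedure.InAp P α (DSystem.f P x) ⇔
        (¬ App (DSystem.H P) (λ y → y ∈ Λ ⊎ y ≡ DSystem.f P x) (DSystem.c P)))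
theorem1p10 em P α loopless x with Run.Stabilisation.eventually-settled P α em loopless (suc x)
... | T , settled = L T x , limit , mk⇔ (thesis⇒consistent settled) (consistent⇒thesis settled)
  where
  open Procedure P α
  open Run P α
  limit : Lim x (L T x)
  limit = T , λ s T≤s y → let L≡ = L-settled settled (n≤1+n x) T≤s in
    mk⇔ (subst (y ∈_) L≡) (subst (y ∈_) (sym L≡))
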